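{- Let $n,k$ be positive integers with $2\leq 2k<n$ and $\gcd(n,k)=d\geq 2$. Then $D(P_{n,k})\leq d\lfloor n/(2d)\rfloor+d+1$.
   Context: For positive integers $n,k$ with $2\le 2k<n$, the generalised Petersen graph $P_{n,k}$ has vertex set $\{u_i,v_i: i\in\{0,\dots,n-1\}\}$ and edge set $\{u_iu_{i+1}, v_iv_{i+k}, u_iv_i : i\in\{0,\dots,n-1\}\}$, indices modulo $n$. A signed graph $(G,E_-)$ is a simple graph $G$ with a set $E_-\subseteq E(G)$ of negative edges; other edges are positive. A cycle is positive if the product of its edge signs is positive; a signed graph is balanced if every cycle is positive. The frustration index $l(G,E_-)$ is the minimum number of edges whose deletion leaves a balanced signed graph, and the maximum frustration is $D(G)=\max_{E_-\subseteq E(G)} l(G,E_-)$. -}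

module Defs where

open import Data.Nat using (ℕ; zero; suc; _+_; _*_; _≤_; _/_)
open import Data.Nat.DivMod using (_mod_)
open import Data.Nat.Divisibility using (_∣_)
open import Data.Fin using (Fin; toℕ; inject₁) renaming (suc to fsuc; zero to fzero)
open import Data.Bool using (Bool; true; false; if_then_else_)
open import Data.Product using (_×_; _,_; Σ)
open import Data.Sum using (_⊎_)
open import Data.List using (List; map; length; allFin)
open import Data.Nat.ListAction using (sum)
open import Data.List.Membership.Propositional using (_∈_)
open import Data.List.Relation.Unary.Unique.Propositional using (Unique)
open import Relation.Binary.PropositionalEquality using (_≡_)
open import Relation.Nullary using (¬_)

-- A signature is the indicator of the negative
-- edge set  E₋ : E → Bool  (true = negative).

module _ {V E : Set} (ends : E → V × V) where

  Joins : E → V → V → Set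
  Joins e a b with ends e
  ... | (x , y) = (x ≡ a × y ≡ b) ⊎ (x ≡ b × y ≡ a)

  record Cycle (S : List E) : Set where
    field
      len      : ℕ
      len≥3    : 3 ≤ len
      vert     : Fin (suc len) → V
      edge     : Fin len → E
      closed   : vert (Data.Fin.fromℕ len) ≡ vert fzero
      distinct : ∀ i j → vert (inject₁ i) ≡ vert (inject₁ j) → i ≡ j
      joins    : ∀ i → Joins (edge i) (vert (inject₁ i)) (vert (fsuc i))
      notDel   : ∀ i → ¬ (edge i ∈ S)

  negCount : (E₋ : E → Bool) {S : List E} → Cycle S → ℕ
  negCount E₋ C = sum (map (λ i → if E₋ (Cycle.edge C i) then 1 else 0) (allFin (Cycle.len C)))

  -- a cycle is positive iff the product of its edge signs is +1,
  -- i.e. it contains an even number of negative edges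
  Positive : (E₋ : E → Bool) {S : List E} → Cycle S → Set
  Positive E₋ C = 2 ∣ negCount E₋ C

  BalancedAfterDeleting : (E₋ : E → Bool) → List E → Set
  BalancedAfterDeleting E₋ S = (C : Cycle S) → Positive E₋ C

  FrustrationIndex≤ : (E₋ : E → Bool) → ℕ → Set
  FrustrationIndex≤ E₋ b =
    Σ (List E) λ S → Unique S × length S ≤ b × BalancedAfterDeleting E₋ S

  -- D(G) ≤ b : every signature has frustration index ≤ b
  MaxFrustration≤ : ℕ → Set
  MaxFrustration≤ b = (E₋ : E → Bool) → FrustrationIndex≤ E₋ b

_+ₘ_ : {n : ℕ} → Fin n → ℕ → Fin n
_+ₘ_ {suc m} i j = (toℕ i + j) mod (suc m)

-- vertices: (false , i) = u_i ,  (true , i) = v_i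
PVertex : ℕ → Set
PVertex n = Bool × Fin n

-- edges: (0 , i) = u_i u_{i+1},  (1 , i) = v_i v_{i+k},  (2 , i) = u_i v_i
PEdge : ℕ → Set
PEdge n = Fin 3 × Fin n

petersenEnds : (n k : ℕ) → PEdge n → PVertex n × PVertex n
petersenEnds n k (fzero , i)               = (false , i) , (false , i +ₘ 1)
petersenEnds n k (fsuc fzero , i)          = (true , i) , (true , i +ₘ k)
petersenEnds n k (fsuc (fsuc fzero) , i)   = (false , i) , (true , i)

-- ⌊ m / q ⌋ (only used with q ≠ 0; value 0 for q = 0 is a dummy)
floorDiv : ℕ → ℕ → ℕ
floorDiv m zero    = 0
floorDiv m (suc q) = m / suc q

-- Write n = m d and k = t d with gcd(m,t) = 1, so t has an inverse u
-- modulo m.  The rim u_0 … u_{n-1} is an n-cycle and the inner vertices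
-- form d disjoint m-cycles: cycle r visits v_{y d + r} for y = 0, t, 2t,
-- … (mod m), block y sitting at position y u (mod m).  Given a signature
-- σ we pick a switching s : V → Bool and delete the edges it leaves
-- frustrated (σ(e) ≠ s(x) ⊕ s(y)); along any remaining cycle the signs
-- telescope, so the rest is balanced (section 2).  The switching
-- propagates signs along the rim and along each inner cycle (prefix
-- xors), leaving at most one frustrated rim edge and one per inner
-- cycle; each inner cycle is then switched as a whole or not, whichever
-- frustrates at most ⌊m/2⌋ of its m spokes (section 4, using the finite
-- sums and majority choice of section 1 and the modular arithmetic of
-- section 3).
module Submission where

open import Defs
open import Data.Nat
  using (ℕ; zero; suc; pred; _+_; _*_; _/_; _%_; _≤_; _<_; _≤?_; z≤n; s≤s; z<s; s<s; NonZero; >-nonZero)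
open import Data.Nat.Properties hiding (_≟_)
open import Data.Nat.DivMod
open import Data.Nat.Divisibility using (_∣_; divides; divides-refl; ∣⇒≤)
open import Data.Nat.GCD using (gcd; gcd[m,n]∣m; gcd[m,n]∣n; module Bézout)
open import Data.Nat.Coprimality using (coprime-/gcd; coprime-Bézout)
open import Data.Nat.ListAction using (sum)
open import Data.Nat.ListAction.Properties using (sum-++)
open import Data.Nat.Tactic.RingSolver using (solve-∀)
open import Data.Fin using (Fin; toℕ; fromℕ; fromℕ<; inject₁) renaming (zero to fzero; suc to fsuc)
open import Data.Fin.Properties using (toℕ-fromℕ<; fromℕ<-toℕ; toℕ<n)
open import Data.Bool using (Bool; true; false; not; _xor_; if_then_else_)
open import Data.Bool.Properties using (_≟_; xor-same; xor-comm; xor-annihilates-not; not-distribʳ-xor; not-involutive)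
open import Data.Product using (Σ-syntax; ∃-syntax; _×_; _,_; proj₁; proj₂)
open import Data.Sum using (inj₁; inj₂)
open import Data.List using (List; []; _∷_; _++_; map; filter; length; tabulate; allFin; cartesianProduct)
open import Data.List.Properties using (map-++; map-∘; map-tabulate)
open import Data.List.Membership.Propositional using (_∈_)
open import Data.List.Membership.Propositional.Properties using (∈-filter⁺; ∈-allFin; ∈-cartesianProduct⁺)
open import Data.List.Relation.Unary.Unique.Propositional using (Unique)
open import Data.List.Relation.Unary.Unique.Propositional.Properties using (filter⁺; allFin⁺; cartesianProduct⁺)
open import Function using (_∘_)
open import Relation.Nullary using (Dec; yes; no; contradiction)
open import Relation.Binary.PropositionalEquality

-- 1. Finite sums

bit : Bool → ℕ
bit b = if b then 1 else 0

bit≤1 : ∀ b → bit b ≤ 1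
bit≤1 false = z≤n
bit≤1 true  = s≤s z≤n

Σ< : ℕ → (ℕ → ℕ) → ℕ
Σ< zero    f = 0
Σ< (suc n) f = f 0 + Σ< n (f ∘ suc)

sum-tabulate : ∀ n (f : Fin n → ℕ) (g : ℕ → ℕ) →
               (∀ j → f j ≡ g (toℕ j)) → sum (tabulate f) ≡ Σ< n g
sum-tabulate zero    f g f≗g = refl
sum-tabulate (suc n) f g f≗g =
  cong₂ _+_ (f≗g fzero) (sum-tabulate n (f ∘ fsuc) (g ∘ suc) (f≗g ∘ fsuc))

Σ<-cong : ∀ n {f g : ℕ → ℕ} → (∀ i → i < n → f i ≡ g i) → Σ< n f ≡ Σ< n g
Σ<-cong zero    eq = refl
Σ<-cong (suc n) eq = cong₂ _+_ (eq 0 z<s) (Σ<-cong n (λ i i<n → eq (suc i) (s<s i<n)))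
Σ<-mono : ∀ n {f g : ℕ → ℕ} → (∀ i → i < n → f i ≤ g i) → Σ< n f ≤ Σ< n g
Σ<-mono zero    le = z≤n
Σ<-mono (suc n) le = +-mono-≤ (le 0 z<s) (Σ<-mono n (λ i i<n → le (suc i) (s<s i<n)))

Σ<-const : ∀ n c → Σ< n (λ _ → c) ≡ n * c
Σ<-const zero    c = refl
Σ<-const (suc n) c = cong (c +_) (Σ<-const n c)

Σ<-zero : ∀ n f → (∀ i → i < n → f i ≡ 0) → Σ< n f ≡ 0
Σ<-zero n f f≡0 = trans (Σ<-cong n f≡0) (trans (Σ<-const n 0) (*-zeroʳ n))

Σ<-+ : ∀ n (f g : ℕ → ℕ) → Σ< n (λ i → f i + g i) ≡ Σ< n f + Σ< n g
Σ<-+ zero    f g = refl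
Σ<-+ (suc n) f g rewrite Σ<-+ n (f ∘ suc) (g ∘ suc) =
  +-assoc-swap (f 0) (g 0) (Σ< n (f ∘ suc)) (Σ< n (g ∘ suc))
  where
    +-assoc-swap : ∀ a b c e → a + b + (c + e) ≡ a + c + (b + e)
    +-assoc-swap = solve-∀

Σ<-split : ∀ a b f → Σ< (a + b) f ≡ Σ< a f + Σ< b (λ i → f (a + i))
Σ<-split zero    b f = refl
Σ<-split (suc a) b f rewrite Σ<-split a b (f ∘ suc) = sym (+-assoc (f 0) _ _)

Σ<-blocks : ∀ m d f → Σ< (m * d) f ≡ Σ< m (λ y → Σ< d (λ r → f (y * d + r)))
Σ<-blocks zero    d f = refl
Σ<-blocks (suc m) d f = begin
  Σ< (d + m * d) f                                           ≡⟨ Σ<-split d (m * d) f ⟩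
  Σ< d f + Σ< (m * d) (λ i → f (d + i))                      ≡⟨ cong (Σ< d f +_) (Σ<-blocks m d (λ i → f (d + i))) ⟩
  Σ< d f + Σ< m (λ y → Σ< d (λ r → f (d + (y * d + r))))
    ≡⟨ cong (Σ< d f +_) (Σ<-cong m (λ y _ → Σ<-cong d (λ r _ → cong f (sym (+-assoc d (y * d) r))))) ⟩
  Σ< d f + Σ< m (λ y → Σ< d (λ r → f (suc y * d + r)))      ∎
  where open ≡-Reasoning

Σ<-swap : ∀ m d (g : ℕ → ℕ → ℕ) → Σ< m (λ y → Σ< d (λ r → g r y)) ≡ Σ< d (λ r → Σ< m (g r))
Σ<-swap zero    d g = sym (Σ<-zero d (λ _ → 0) (λ _ _ → refl))
Σ<-swap (suc m) d g rewrite Σ<-swap m d (λ r y → g r (suc y)) =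
  sym (Σ<-+ d (λ r → g r 0) (λ r → Σ< m (g r ∘ suc)))

Σ<-bits≤ : ∀ n (f : ℕ → Bool) → Σ< n (bit ∘ f) ≤ n
Σ<-bits≤ zero    f = z≤n
Σ<-bits≤ (suc n) f = +-mono-≤ (bit≤1 (f 0)) (Σ<-bits≤ n (f ∘ suc))

Σ<-complement : ∀ n (f : ℕ → Bool) → Σ< n (bit ∘ not ∘ f) + Σ< n (bit ∘ f) ≡ n
Σ<-complement zero    f = refl
Σ<-complement (suc n) f with f 0 | Σ<-complement n (f ∘ suc)
... | false | eq = cong suc eq
... | true  | eq = trans (+-suc _ _) (cong suc eq)

Σ<-single : ∀ n f i₀ c → (∀ i → i < n → i ≢ i₀ → f i ≡ 0) → f i₀ ≤ c → Σ< n f ≤ c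
Σ<-single zero    f i₀       c others fi₀≤c = z≤n
Σ<-single (suc n) f zero     c others fi₀≤c
  rewrite Σ<-zero n (f ∘ suc) (λ i i<n → others (suc i) (s<s i<n) (λ ()))
  = subst (_≤ c) (sym (+-identityʳ (f 0))) fi₀≤c
Σ<-single (suc n) f (suc i₀) c others fi₀≤c
  rewrite others 0 z<s (λ ())
  = Σ<-single n (f ∘ suc) i₀ c (λ i i<n i≢i₀ → others (suc i) (s<s i<n) (i≢i₀ ∘ suc-injective)) fi₀≤c

≤-half : ∀ c m → c + c ≤ m → c ≤ m / 2
≤-half c m c+c≤m =
  subst (_≤ m / 2) (m*n/n≡m c 2) (/-monoˡ-≤ 2 (subst (_≤ m) (double c) c+c≤m))
  where
    double : ∀ c → c + c ≡ c * 2
    double = solve-∀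

majority : ∀ m (g : ℕ → Bool) → Σ[ c ∈ Bool ] Σ< m (λ y → bit (c xor g y)) ≤ m / 2
majority m g with Σ< m (bit ∘ g) + Σ< m (bit ∘ g) ≤? m
... | yes few  = false , ≤-half _ m few
... | no  many = true , ≤-half _ m (<⇒≤ (begin-strict
        flips + flips <⟨ +-monoʳ-< flips flips<trues ⟩
        flips + trues ≡⟨ Σ<-complement m g ⟩
        m             ∎))
  where
    open ≤-Reasoning
    trues flips : ℕ
    trues = Σ< m (bit ∘ g)
    flips = Σ< m (bit ∘ not ∘ g)
    flips<trues : flips < trues
    flips<trues = +-cancelʳ-< trues flips trues (begin-strict
      flips + trues ≡⟨ Σ<-complement m g ⟩
      m             <⟨ ≰⇒> many ⟩
      trues + trues ∎)

-- 2. Switching: deleting the edges frustrated by a switching balances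

-- an edge of sign σe whose endpoints are switched by a and b is
-- frustrated iff σe ≠ a ⊕ b
frustration : Bool → Bool → Bool → Bool
frustration σe a b = σe xor (a xor b)

frustration-false⇒sign : ∀ σe a b → frustration σe a b ≡ false → σe ≡ a xor b
frustration-false⇒sign false false false _ = refl
frustration-false⇒sign false true  true  _ = refl
frustration-false⇒sign true  false true  _ = refl
frustration-false⇒sign true  true  false _ = refl

frustration-sym : ∀ σe a b → frustration σe a b ≡ frustration σe b a
frustration-sym σe a b = cong (σe xor_) (xor-comm a b)

frustration-switch-both : ∀ c σe a b → frustration σe (c xor a) (c xor b) ≡ frustration σe a b
frustration-switch-both false σe a b = refl
frustration-switch-both true  σe a b = cong (σe xor_) (xor-annihilates-not a b)

frustration-switch-right : ∀ c σe a b → frustration σe a (c xor b) ≡ c xor frustration σe a b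
frustration-switch-right false σe a b = refl
frustration-switch-right true  σe a b =
  sym (trans (not-distribʳ-xor σe (a xor b)) (cong (σe xor_) (not-distribʳ-xor a b)))

prefixXor : (ℕ → Bool) → ℕ → Bool
prefixXor f zero    = false
prefixXor f (suc i) = prefixXor f i xor f i

prefixXor-unfrustrated : ∀ f i → frustration (f i) (prefixXor f i) (prefixXor f (suc i)) ≡ false
prefixXor-unfrustrated f i with f i | prefixXor f i
... | false | false = refl
... | false | true  = refl
... | true  | false = refl
... | true  | true  = refl

⊕F : ∀ n → (Fin n → Bool) → Bool
⊕F zero    f = false
⊕F (suc n) f = f fzero xor ⊕F n (f ∘ fsuc)

⊕F-cong : ∀ n {f g : Fin n → Bool} → (∀ i → f i ≡ g i) → ⊕F n f ≡ ⊕F n g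
⊕F-cong zero    eq = refl
⊕F-cong (suc n) eq = cong₂ _xor_ (eq fzero) (⊕F-cong n (eq ∘ fsuc))

⊕F-telescope : ∀ L (b : Fin (suc L) → Bool) →
               ⊕F L (λ i → b (inject₁ i) xor b (fsuc i)) ≡ b fzero xor b (fromℕ L)
⊕F-telescope zero    b = sym (xor-same (b fzero))
⊕F-telescope (suc L) b rewrite ⊕F-telescope L (b ∘ fsuc) =
  cancel-middle (b fzero) (b (fsuc fzero)) (b (fromℕ (suc L)))
  where
    cancel-middle : ∀ x y z → (x xor y) xor (y xor z) ≡ x xor z
    cancel-middle false false z = refl
    cancel-middle false true  z = not-involutive z
    cancel-middle true  false z = refl
    cancel-middle true  true  z = refl

count-parity : ∀ n (f : Fin n → Bool) → ∃[ q ] sum (tabulate (bit ∘ f)) ≡ bit (⊕F n f) + q * 2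
count-parity zero    f = 0 , refl
count-parity (suc n) f with f fzero | ⊕F n (f ∘ fsuc) | count-parity n (f ∘ fsuc)
... | false | p     | q , eq = q , eq
... | true  | false | q , eq = q , cong suc eq
... | true  | true  | q , eq = suc q , cong suc eq

even-count : ∀ n (f : Fin n → Bool) → ⊕F n f ≡ false → 2 ∣ sum (tabulate (bit ∘ f))
even-count n f ⊕≡false with count-parity n f
... | q , eq = divides q (trans eq (cong (λ x → bit x + q * 2) ⊕≡false))

count : {A : Set} → (A → Bool) → List A → ℕ
count h xs = sum (map (bit ∘ h) xs)

length-filter-true : {A : Set} (h : A → Bool) (xs : List A) →
                     length (filter (λ x → h x ≟ true) xs) ≡ count h xs
length-filter-true h []       = refl
length-filter-true h (x ∷ xs) with h x
... | true  = cong suc (length-filter-true h xs)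
... | false = length-filter-true h xs

count-++ : {A : Set} (h : A → Bool) (xs ys : List A) → count h (xs ++ ys) ≡ count h xs + count h ys
count-++ h xs ys = trans (cong sum (map-++ (bit ∘ h) xs ys)) (sum-++ (map (bit ∘ h) xs) _)

module Switching {V E : Set} (ends : E → V × V) (σ : E → Bool) (s : V → Bool) where

  frustrated : E → Bool
  frustrated e = frustration (σ e) (s (proj₁ (ends e))) (s (proj₂ (ends e)))

  unfrustrated-sign : ∀ e a b → Joins ends e a b → frustrated e ≡ false → σ e ≡ s a xor s b
  unfrustrated-sign e a b joins unfr with ends e
  unfrustrated-sign e a b (inj₁ (refl , refl)) unfr | x , y =
    frustration-false⇒sign (σ e) (s x) (s y) unfr
  unfrustrated-sign e a b (inj₂ (refl , refl)) unfr | x , y =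
    frustration-false⇒sign (σ e) (s y) (s x) (trans (frustration-sym (σ e) (s y) (s x)) unfr)

  -- every cycle avoiding the frustrated edges has signs s(wᵢ) ⊕ s(wᵢ₊₁),
  -- which telescope to 0: the cycle is positive
  switching-balances : (S : List E) → (∀ e → frustrated e ≡ true → e ∈ S) →
                       BalancedAfterDeleting ends σ S
  switching-balances S frustrated⊆S C =
    subst (2 ∣_) (sym (cong sum (map-tabulate (λ i → i) (bit ∘ σ ∘ edge))))
          (even-count len (σ ∘ edge) signs-cancel)
    where
      open Cycle C
      sw : Fin (suc len) → Bool
      sw = s ∘ vert

      unfrustrated : ∀ i → frustrated (edge i) ≡ false
      unfrustrated i with frustrated (edge i) in eq
      ... | true  = contradiction (frustrated⊆S (edge i) eq) (notDel i)
      ... | false = refl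

      signs-cancel : ⊕F len (σ ∘ edge) ≡ false
      signs-cancel = begin
        ⊕F len (σ ∘ edge)
          ≡⟨ ⊕F-cong len (λ i → unfrustrated-sign (edge i) _ _ (joins i) (unfrustrated i)) ⟩
        ⊕F len (λ i → sw (inject₁ i) xor sw (fsuc i)) ≡⟨ ⊕F-telescope len sw ⟩
        sw fzero xor sw (fromℕ len)                   ≡⟨ cong (λ v → sw fzero xor s v) closed ⟩
        sw fzero xor sw fzero                         ≡⟨ xor-same (sw fzero) ⟩
        false                                         ∎
        where open ≡-Reasoning

  frustrationIndex≤ : (es : List E) → Unique es → (∀ e → e ∈ es) →
                      ∀ b → count frustrated es ≤ b → FrustrationIndex≤ ends σ b
  frustrationIndex≤ es unique complete b count≤b =
      filter frustrated? es
    , filter⁺ frustrated? unique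
    , subst (_≤ b) (sym (length-filter-true frustrated es)) count≤b
    , switching-balances (filter frustrated? es) (λ e fr → ∈-filter⁺ frustrated? (complete e) fr)
    where
      frustrated? : (e : E) → Dec (frustrated e ≡ true)
      frustrated? e = frustrated e ≟ true

-- 3. Arithmetic of the inner cycles: index y d + r, residue r < d

digits-% : ∀ y r d .{{_ : NonZero d}} → r < d → (y * d + r) % d ≡ r
digits-% y r d r<d = trans (%-remove-+ˡ r (divides-refl y)) (m<n⇒m%n≡m r<d)
digits-/ : ∀ y r d .{{_ : NonZero d}} → r < d → (y * d + r) / d ≡ y
digits-/ y r d r<d = begin
  (y * d + r) / d   ≡⟨ +-distrib-/-∣ˡ r (divides-refl y) ⟩
  y * d / d + r / d ≡⟨ cong₂ _+_ (m*n/n≡m y d) (m<n⇒m/n≡0 r<d) ⟩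
  y + 0             ≡⟨ +-identityʳ y ⟩
  y                 ∎
  where open ≡-Reasoning

shift-block : ∀ y r t d m .{{_ : NonZero m}} .{{_ : NonZero (m * d)}} → r < d →
              (y * d + r + t * d) % (m * d) ≡ ((y + t) % m) * d + r
shift-block y r t d m r<d = begin
  (y * d + r + t * d) % (m * d)         ≡⟨ cong (_% (m * d)) (regroup y r t d) ⟩
  ((y + t) * d + r) % (m * d)           ≡⟨ [m*n+o]%[p*n]≡[m*n]%[p*n]+o (y + t) m r<d ⟩
  ((y + t) * d) % (m * d) + r           ≡⟨ cong (_+ r) (m%n*o≡m*o%[n*o] (y + t) m d) ⟨
  ((y + t) % m) * d + r                 ∎
  where
    open ≡-Reasoning
    regroup : ∀ y r t d → y * d + r + t * d ≡ (y + t) * d + r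
    regroup = solve-∀

[m%n*o]%n≡[m*o]%n : ∀ a b m .{{_ : NonZero m}} → (a % m * b) % m ≡ (a * b) % m
[m%n*o]%n≡[m*o]%n a b m = begin
  (a % m * b) % m            ≡⟨ %-distribˡ-* (a % m) b m ⟩
  (a % m % m * (b % m)) % m  ≡⟨ cong (λ x → (x * (b % m)) % m) (m%n%n≡m%n a m) ⟩
  (a % m * (b % m)) % m      ≡⟨ %-distribˡ-* a b m ⟨
  (a * b) % m                ∎
  where open ≡-Reasoning

module InverseModulo (m t u : ℕ) .{{_ : NonZero m}} (t*u≡1 : (t * u) % m ≡ 1) where

  -- the position of block y on its inner cycle
  position : ℕ → ℕ
  position y = (y * u) % m

  blockAt : ℕ → ℕ
  blockAt j = (j * t) % m

  position-step : ∀ y → position ((y + t) % m) ≡ suc (position y) % m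
  position-step y = begin
    ((y + t) % m * u) % m            ≡⟨ [m%n*o]%n≡[m*o]%n (y + t) u m ⟩
    ((y + t) * u) % m                ≡⟨ cong (_% m) (*-distribʳ-+ u y t) ⟩
    (y * u + t * u) % m              ≡⟨ %-distribˡ-+ (y * u) (t * u) m ⟩
    ((y * u) % m + (t * u) % m) % m  ≡⟨ cong (λ x → ((y * u) % m + x) % m) t*u≡1 ⟩
    ((y * u) % m + 1) % m            ≡⟨ cong (_% m) (+-comm _ 1) ⟩
    suc ((y * u) % m) % m            ∎
    where open ≡-Reasoning

  blockAt-position : ∀ y → y < m → blockAt (position y) ≡ y
  blockAt-position y y<m = begin
    ((y * u) % m * t) % m         ≡⟨ [m%n*o]%n≡[m*o]%n (y * u) t m ⟩
    (y * u * t) % m               ≡⟨ cong (_% m) (reassoc y u t) ⟩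
    (y * (t * u)) % m             ≡⟨ %-distribˡ-* y (t * u) m ⟩
    ((y % m) * ((t * u) % m)) % m ≡⟨ cong (λ x → ((y % m) * x) % m) t*u≡1 ⟩
    ((y % m) * 1) % m             ≡⟨ cong (_% m) (*-identityʳ (y % m)) ⟩
    (y % m) % m                   ≡⟨ m%n%n≡m%n y m ⟩
    y % m                         ≡⟨ m<n⇒m%n≡m y<m ⟩
    y                             ∎
    where
      open ≡-Reasoning
      reassoc : ∀ y u t → y * u * t ≡ y * (t * u)
      reassoc = solve-∀

-- 4. A switching of P_{m d, t d} with few frustrated edges

rim inner spoke : Fin 3
rim   = fzero
inner = fsuc fzero
spoke = fsuc (fsuc fzero)

petersenEdges : ∀ n → List (PEdge n)
petersenEdges n = cartesianProduct (allFin 3) (allFin n)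

petersenEdges-unique : ∀ n → Unique (petersenEdges n)
petersenEdges-unique n = cartesianProduct⁺ (allFin⁺ 3) (allFin⁺ n)
petersenEdges-complete : ∀ n (e : PEdge n) → e ∈ petersenEdges n
petersenEdges-complete n (c , j) = ∈-cartesianProduct⁺ (∈-allFin c) (∈-allFin j)

count-class : ∀ n (h : PEdge n → Bool) c (F : ℕ → Bool) → (∀ j → h (c , j) ≡ F (toℕ j)) →
              count h (map (c ,_) (allFin n)) ≡ Σ< n (bit ∘ F)
count-class n h c F h≗F = begin
  sum (map (bit ∘ h) (map (c ,_) (allFin n)))  ≡⟨ cong sum (map-∘ (allFin n)) ⟨
  sum (map (bit ∘ h ∘ (c ,_)) (tabulate (λ i → i))) ≡⟨ cong sum (map-tabulate (λ i → i) (bit ∘ h ∘ (c ,_))) ⟩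
  sum (tabulate (bit ∘ h ∘ (c ,_)))            ≡⟨ sum-tabulate n _ (bit ∘ F) (cong bit ∘ h≗F) ⟩
  Σ< n (bit ∘ F)                               ∎
  where open ≡-Reasoning

count-petersenEdges : ∀ n (h : PEdge n → Bool) (F₀ F₁ F₂ : ℕ → Bool) →
                      (∀ j → h (rim , j) ≡ F₀ (toℕ j)) → (∀ j → h (inner , j) ≡ F₁ (toℕ j)) →
                      (∀ j → h (spoke , j) ≡ F₂ (toℕ j)) →
                      count h (petersenEdges n) ≡ Σ< n (bit ∘ F₀) + (Σ< n (bit ∘ F₁) + (Σ< n (bit ∘ F₂) + 0))
count-petersenEdges n h F₀ F₁ F₂ h₀ h₁ h₂ = begin
  count h (E rim ++ (E inner ++ (E spoke ++ [])))
    ≡⟨ count-++ h (E rim) _ ⟩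
  count h (E rim) + count h (E inner ++ (E spoke ++ []))
    ≡⟨ cong (count h (E rim) +_) (trans (count-++ h (E inner) _) (cong (count h (E inner) +_) (count-++ h (E spoke) []))) ⟩
  count h (E rim) + (count h (E inner) + (count h (E spoke) + 0))
    ≡⟨ cong₂ _+_ (count-class n h rim F₀ h₀)
         (cong₂ _+_ (count-class n h inner F₁ h₁) (cong (_+ 0) (count-class n h spoke F₂ h₂))) ⟩
  Σ< n (bit ∘ F₀) + (Σ< n (bit ∘ F₁) + (Σ< n (bit ∘ F₂) + 0)) ∎
  where
    open ≡-Reasoning
    E : Fin 3 → List (PEdge n)
    E c = map (c ,_) (allFin n)

toℕ-+ₘ : ∀ {n} .{{_ : NonZero n}} (i : Fin n) j → toℕ (i +ₘ j) ≡ (toℕ i + j) % n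
toℕ-+ₘ {suc n} i j = toℕ-fromℕ< _

suc-< : ∀ {i n} → i < n → i ≢ pred n → suc i < n
suc-< i<n i≢ = ≤∧≢⇒< i<n (i≢ ∘ cong pred)

module PetersenSwitching (m d t u : ℕ) {{_ : NonZero m}} {{_ : NonZero d}}
                         (t*u≡1 : (t * u) % m ≡ 1) (σ : PEdge (m * d) → Bool) where

  open InverseModulo m t u t*u≡1

  N K : ℕ
  N = m * d
  K = t * d

  instance
    N≢0 : NonZero N
    N≢0 = m*n≢0 m d

  -- the sign of the edge of class c with index i (false for i ≥ N)
  sign : Fin 3 → ℕ → Bool
  sign c i with i <? N
  ... | yes i<N = σ (c , fromℕ< i<N)
  ... | no  _   = false

  sign-toℕ : ∀ c j → sign c (toℕ j) ≡ σ (c , j)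
  sign-toℕ c j with toℕ j <? N
  ... | yes j<N = cong (λ x → σ (c , x)) (fromℕ<-toℕ j j<N)
  ... | no  j≮N = contradiction (toℕ<n j) j≮N

  rimSwitch : ℕ → Bool
  rimSwitch = prefixXor (sign rim)

  cyclePotential : ℕ → ℕ → Bool
  cyclePotential r = prefixXor (λ j → sign inner (blockAt j * d + r))

  spokeFrustration : ℕ → ℕ → Bool
  spokeFrustration r y =
    frustration (sign spoke (y * d + r)) (rimSwitch (y * d + r)) (cyclePotential r (position y))

  -- cycle r is switched as a whole iff that frustrates fewer spokes
  orientation : ℕ → Bool
  orientation r = proj₁ (majority m (spokeFrustration r))

  -- the switching of v_i: cycle r = i mod d, block y = i / d
  innerSwitch : ℕ → Bool
  innerSwitch i = orientation (i % d) xor cyclePotential (i % d) (position (i / d))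

  innerSwitch-block : ∀ y r → r < d →
                      innerSwitch (y * d + r) ≡ orientation r xor cyclePotential r (position y)
  innerSwitch-block y r r<d =
    cong₂ (λ r′ y′ → orientation r′ xor cyclePotential r′ (position y′))
          (digits-% y r d r<d) (digits-/ y r d r<d)

  switch : PVertex N → Bool
  switch (false , j) = rimSwitch (toℕ j)
  switch (true  , j) = innerSwitch (toℕ j)

  open Switching (petersenEnds N K) σ switch

  rimF innerF spokeF : ℕ → Bool
  rimF   i = frustration (sign rim i)   (rimSwitch i)   (rimSwitch ((i + 1) % N))
  innerF i = frustration (sign inner i) (innerSwitch i) (innerSwitch ((i + K) % N))
  spokeF i = frustration (sign spoke i) (rimSwitch i)   (innerSwitch i)

  frustrated-rim : ∀ j → frustrated (rim , j) ≡ rimF (toℕ j)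
  frustrated-rim j rewrite sign-toℕ rim j | toℕ-+ₘ j 1 = refl
  frustrated-inner : ∀ j → frustrated (inner , j) ≡ innerF (toℕ j)
  frustrated-inner j rewrite sign-toℕ inner j | toℕ-+ₘ j K = refl
  frustrated-spoke : ∀ j → frustrated (spoke , j) ≡ spokeF (toℕ j)
  frustrated-spoke j rewrite sign-toℕ spoke j = refl

  -- only the rim edge u_{N-1} u_0 can be frustrated
  rim-bound : Σ< N (bit ∘ rimF) ≤ 1
  rim-bound = Σ<-single N (bit ∘ rimF) (pred N) 1
    (λ i i<N i≢ → cong bit (rimF-unfrustrated i (suc-< i<N i≢))) (bit≤1 _)
    where
      rimF-unfrustrated : ∀ i → suc i < N → rimF i ≡ false
      rimF-unfrustrated i 1+i<N rewrite +-comm i 1 | m<n⇒m%n≡m 1+i<N =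
        prefixXor-unfrustrated (sign rim) i

  -- on inner cycle r only the edge leaving the last position can be frustrated
  innerF-unfrustrated : ∀ y r → y < m → r < d → y ≢ blockAt (pred m) → innerF (y * d + r) ≡ false
  innerF-unfrustrated y r y<m r<d y≢last = begin
    frustration (sign inner i) (innerSwitch i) (innerSwitch ((i + K) % N))
      ≡⟨ cong₂ (frustration (sign inner i)) (innerSwitch-block y r r<d)
           (trans (cong innerSwitch (shift-block y r t d m r<d)) (innerSwitch-block ((y + t) % m) r r<d)) ⟩
    frustration (sign inner i) (o xor P p) (o xor P (position ((y + t) % m)))
      ≡⟨ cong (λ q → frustration (sign inner i) (o xor P p) (o xor P q)) next-position ⟩
    frustration (sign inner i) (o xor P p) (o xor P (suc p))
      ≡⟨ frustration-switch-both o (sign inner i) (P p) (P (suc p)) ⟩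
    frustration (sign inner (y * d + r)) (P p) (P (suc p))
      ≡⟨ cong (λ b → frustration (sign inner (b * d + r)) (P p) (P (suc p))) (blockAt-position y y<m) ⟨
    frustration (sign inner (blockAt p * d + r)) (P p) (P (suc p))
      ≡⟨ prefixXor-unfrustrated (λ j → sign inner (blockAt j * d + r)) p ⟩
    false ∎
    where
      open ≡-Reasoning
      i p : ℕ
      i = y * d + r
      p = position y
      o : Bool
      o = orientation r
      P : ℕ → Bool
      P = cyclePotential r
      next-position : position ((y + t) % m) ≡ suc p
      next-position = trans (position-step y) (m<n⇒m%n≡m (suc-< (m%n<n (y * u) m)
        (λ p≡last → y≢last (trans (sym (blockAt-position y y<m)) (cong blockAt p≡last)))))

  -- hence at most one frustrated edge per inner cycle
  inner-bound : Σ< N (bit ∘ innerF) ≤ d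
  inner-bound = begin
    Σ< N (bit ∘ innerF)                                  ≡⟨ Σ<-blocks m d (bit ∘ innerF) ⟩
    Σ< m (λ y → Σ< d (λ r → bit (innerF (y * d + r))))
      ≤⟨ Σ<-single m _ (blockAt (pred m)) d
           (λ y y<m y≢ → Σ<-zero d _ (λ r r<d → cong bit (innerF-unfrustrated y r y<m r<d y≢)))
           (Σ<-bits≤ d _) ⟩
    d                                                    ∎
    where open ≤-Reasoning

  spokeF-block : ∀ y r → r < d → spokeF (y * d + r) ≡ orientation r xor spokeFrustration r y
  spokeF-block y r r<d =
    trans (cong (frustration (sign spoke (y * d + r)) (rimSwitch (y * d + r))) (innerSwitch-block y r r<d))
          (frustration-switch-right (orientation r) (sign spoke (y * d + r)) (rimSwitch (y * d + r))
                                    (cyclePotential r (position y)))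

  -- by the choice of orientations, at most ⌊m/2⌋ frustrated spokes per inner cycle
  spoke-bound : Σ< N (bit ∘ spokeF) ≤ d * (m / 2)
  spoke-bound = begin
    Σ< N (bit ∘ spokeF)                                  ≡⟨ Σ<-blocks m d (bit ∘ spokeF) ⟩
    Σ< m (λ y → Σ< d (λ r → bit (spokeF (y * d + r))))  ≡⟨ Σ<-swap m d (λ r y → bit (spokeF (y * d + r))) ⟩
    Σ< d (λ r → Σ< m (λ y → bit (spokeF (y * d + r))))
      ≤⟨ Σ<-mono d (λ r r<d → begin
           Σ< m (λ y → bit (spokeF (y * d + r)))
             ≡⟨ Σ<-cong m (λ y _ → cong bit (spokeF-block y r r<d)) ⟩
           Σ< m (λ y → bit (orientation r xor spokeFrustration r y))
             ≤⟨ proj₂ (majority m (spokeFrustration r)) ⟩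
           m / 2 ∎) ⟩
    Σ< d (λ _ → m / 2)                                   ≡⟨ Σ<-const d (m / 2) ⟩
    d * (m / 2)                                          ∎
    where open ≤-Reasoning

  petersen-switching : FrustrationIndex≤ (petersenEnds N K) σ (d * (m / 2) + d + 1)
  petersen-switching =
    frustrationIndex≤ (petersenEdges N) (petersenEdges-unique N) (petersenEdges-complete N) _ (begin
      count frustrated (petersenEdges N)
        ≡⟨ count-petersenEdges N frustrated rimF innerF spokeF frustrated-rim frustrated-inner frustrated-spoke ⟩
      Σ< N (bit ∘ rimF) + (Σ< N (bit ∘ innerF) + (Σ< N (bit ∘ spokeF) + 0))
        ≤⟨ +-mono-≤ rim-bound (+-mono-≤ inner-bound (+-monoˡ-≤ 0 spoke-bound)) ⟩
      1 + (d + (d * (m / 2) + 0))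
        ≡⟨ rearrange d (d * (m / 2)) ⟩
      d * (m / 2) + d + 1 ∎)
    where
      open ≤-Reasoning
      rearrange : ∀ d x → 1 + (d + (x + 0)) ≡ x + d + 1
      rearrange = solve-∀

-- 5. From gcd(n, k) = d to the setting of section 4

modular-inverse : ∀ m t .{{_ : NonZero m}} → 2 ≤ m → Bézout.Identity 1 m t → ∃[ u ] (t * u) % m ≡ 1
modular-inverse (suc zero)    t (s≤s ()) _
modular-inverse (suc (suc m)) t _ (Bézout.-+ x y 1+xM≡yt) = y , (begin
  (t * y) % M       ≡⟨ cong (_% M) (*-comm t y) ⟩
  (y * t) % M       ≡⟨ cong (_% M) 1+xM≡yt ⟨
  (1 + x * M) % M   ≡⟨ [m+kn]%n≡m%n 1 x M ⟩
  1                 ∎)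
  where
    open ≡-Reasoning
    M : ℕ
    M = suc (suc m)
modular-inverse (suc (suc m)) t _ (Bézout.+- x y 1+yt≡xM) = y * suc m , (begin
  (t * (y * suc m)) % M                 ≡⟨ [m+kn]%n≡m%n (t * (y * suc m)) x M ⟨
  (t * (y * suc m) + x * M) % M         ≡⟨ cong (λ z → (t * (y * suc m) + z) % M) 1+yt≡xM ⟨
  (t * (y * suc m) + (1 + y * t)) % M   ≡⟨ cong (_% M) (regroup t y m) ⟩
  (1 + (t * y) * M) % M                 ≡⟨ [m+kn]%n≡m%n 1 (t * y) M ⟩
  1                                     ∎)
  where
    open ≡-Reasoning
    M : ℕ
    M = suc (suc m)
    regroup : ∀ t y m → t * (y * suc m) + (1 + y * t) ≡ 1 + (t * y) * suc (suc m)
    regroup = solve-∀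

cofactor-≥2 : ∀ {n k} m d → n ≡ m * d → d ∣ k → 0 < k → k < n → 2 ≤ m
cofactor-≥2 0             d refl _   _   ()
cofactor-≥2 {k = k} 1     d refl d∣k 0<k k<n =
  contradiction (subst (_≤ k) (sym (+-identityʳ d)) (∣⇒≤ {{>-nonZero 0<k}} d∣k)) (<⇒≱ k<n)
cofactor-≥2 (suc (suc m)) d _    _   _   _   = s≤s (s≤s z≤n)

floorDiv-multiple : ∀ m d .{{_ : NonZero d}} → floorDiv (m * d) (2 * d) ≡ m / 2
floorDiv-multiple m (suc d) = begin
  m * suc d / (2 * suc d)     ≡⟨ /-congˡ (*-comm m (suc d)) ⟩
  suc d * m / (2 * suc d)     ≡⟨ /-congʳ {m = suc d * m} (*-comm 2 (suc d)) ⟩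
  suc d * m / (suc d * 2)     ≡⟨ m*n/m*o≡n/o (suc d) m 2 ⟩
  m / 2                       ∎
  where open ≡-Reasoning

theorem4p1 : (n k : ℕ) → 1 ≤ k → 2 * k < n → 2 ≤ gcd n k →
             MaxFrustration≤ (petersenEnds n k)
               (gcd n k * floorDiv n (2 * gcd n k) + gcd n k + 1)
theorem4p1 n k 0<k 2k<n 2≤g =
  subst₂ Bound (m/n*n≡m g∣n) (m/n*n≡m g∣k) λ σ →
    subst (FrustrationIndex≤ (petersenEnds (m * g) (t * g)) σ)
          (cong (λ x → g * x + g + 1) (sym (floorDiv-multiple m g)))
          (PetersenSwitching.petersen-switching m g t (proj₁ inverse) (proj₂ inverse) σ)
  where
    g : ℕ
    g = gcd n k
    instance
      g≢0 : NonZero g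
      g≢0 = >-nonZero (≤-trans (s≤s z≤n) 2≤g)
    m t : ℕ
    m = n / g
    t = k / g
    Bound : ℕ → ℕ → Set
    Bound n′ k′ = MaxFrustration≤ (petersenEnds n′ k′) (g * floorDiv n′ (2 * g) + g + 1)
    g∣n : g ∣ n
    g∣n = gcd[m,n]∣m n k
    g∣k : g ∣ k
    g∣k = gcd[m,n]∣n n k
    m≥2 : 2 ≤ m
    m≥2 = cofactor-≥2 m g (sym (m/n*n≡m g∣n)) g∣k 0<k (≤-<-trans (m≤m+n k (k + 0)) 2k<n)
    instance
      m≢0 : NonZero m
      m≢0 = >-nonZero (≤-trans (s≤s z≤n) m≥2)
    inverse : ∃[ u ] (t * u) % m ≡ 1
    inverse = modular-inverse m t m≥2 (coprime-Bézout (coprime-/gcd n k))
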